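{- For every positive integer $d$, \[ \sum_{n\geq 0}C_{n}^{(d)}t^n=\frac{1}{(1-t^d)\cdot(1-t)(1-t^2)(1-t^3)\cdots (1-t^d)} \] as formal power series.
   Context: $\Lambda_d=\mathbb{Z}_{\geq0}^d$ with basis $\mathbf{e}(1),\dots,\mathbf{e}(d)$; $X_d=\{\mathbf{e}(k)-\mathbf{e}(i)-\mathbf{e}(j): i,j,k\in\{1,\dots,d\},\ d\mid k-i-j\}$; for $\mathbf{v},\mathbf{w}\in\Lambda_d$, $\mathbf{v}\lessdot\mathbf{w}$ iff $\mathbf{v}-\mathbf{w}\in X_d$; $\prec$ is the transitive closure of $\lessdot$ on $\Lambda_d$. $C_n^{(d)}=|\{n\mathbf{e}(1)\}\cup\{\mathbf{w}\in\Lambda_d:\mathbf{w}\prec n\mathbf{e}(1)\}|$. -}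

module Defs where

open import Data.Nat as ℕ using (ℕ; zero; suc; _≡ᵇ_)
open import Data.Integer as ℤ using (ℤ; +_; -_; _+_; _-_; _*_)
open import Data.Integer.Divisibility using (_∣_)
open import Data.Fin using (Fin; toℕ)
open import Data.Vec using (Vec; lookup; tabulate)
open import Data.List using (List; length; upTo)
open import Data.List.Membership.Propositional using (_∈_)
open import Data.List.Relation.Unary.Unique.Propositional using (Unique)
open import Data.Product using (Σ; ∃; _×_; _,_)
open import Data.Sum using (_⊎_)
open import Data.Bool using (if_then_else_)
open import Function.Bundles using (_⇔_)
open import Relation.Binary.PropositionalEquality using (_≡_)
open import Relation.Binary.Construct.Closure.Transitive using (TransClosure)

-- Λ_d = ℤ≥0^d, represented as vectors of length d.
-- Coordinate index l : Fin d stands for the paper's index toℕ l + 1 ∈ {1,…,d}.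
Λ : ℕ → Set
Λ d = Vec ℕ d

idx : ∀ {d} → Fin d → ℤ
idx l = + (suc (toℕ l))

δ : ∀ {d} → Fin d → Fin d → ℤ
δ k l = if toℕ k ≡ᵇ toℕ l then + 1 else + 0

record _⋖_ {d : ℕ} (v w : Λ d) : Set where
  constructor step
  field
    i j k : Fin d
    divides : + d ∣ (idx k - idx i - idx j)
    diff : ∀ (l : Fin d) →
      + lookup v l - + lookup w l ≡ δ k l - δ i l - δ j l

_≺_ : ∀ {d} → Λ d → Λ d → Set
_≺_ = TransClosure _⋖_

ne₁ : ∀ {d} → ℕ → Λ d
ne₁ n = tabulate (λ l → if toℕ l ≡ᵇ 0 then n else 0)

Below : (d n : ℕ) → Λ d → Set
Below d n w = (w ≡ ne₁ n) ⊎ (w ≺ ne₁ n)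

HasCard : (d n c : ℕ) → Set
HasCard d n c = Σ (List (Λ d)) λ xs →
  Unique xs × (∀ w → (w ∈ xs) ⇔ Below d n w) × (length xs ≡ c)

PS : Set
PS = ℕ → ℤ

sumℤ : List ℤ → ℤ
sumℤ = Data.List.foldr _+_ (+ 0)

_⊛_ : PS → PS → PS
(f ⊛ g) n = sumℤ (Data.List.map (λ m → f m * g (n ℕ.∸ m)) (upTo (suc n)))

𝟙 : PS
𝟙 zero = + 1
𝟙 (suc _) = + 0

1-t^ : ℕ → PS
1-t^ k n = 𝟙 n - (if n ≡ᵇ k then + 1 else + 0)

∏1-t^ : ℕ → PS
∏1-t^ zero = 𝟙
∏1-t^ (suc m) = ∏1-t^ m ⊛ 1-t^ (suc m)

ofℕ : (ℕ → ℕ) → PS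
ofℕ c n = + c n

module Submission where

-- Give e(i) the weight i. A step v ⋖ w replaces e(i) + e(j) in w by e(k) in v, and for indices in
-- 1..d the condition d ∣ k - i - j means i + j = k or i + j = k + d. So the weight of v is that of
-- w or d less, and everything below n e(1) has weight n - d·m for some m. Conversely each such w
-- lies below n e(1): the step w ⋖ w + e(d) adds d to the weight, and splitting e(k+1) into
-- e(k) + e(1) keeps the weight and ends at n e(1). Hence C_n^(d) counts the solutions (m, w) of
-- d·m + Σ i·w(i) = n. Their generating function satisfies the recursion of a product of
-- geometric series: multiplying by 1 - t^s removes one variable of weight s.

open import Defs
open import Data.Nat.Base as ℕ using (ℕ; zero; suc; _≤_; _<_; _∸_; _≤ᵇ_; _≡ᵇ_; z≤n; s≤s; s≤s⁻¹)
import Data.Nat.Properties as ℕ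
open import Data.Nat.Divisibility using (_∣_; divides; _∣0; ∣-refl)
open import Data.Nat.Induction using (<-wellFounded)
open import Data.Integer.Base as ℤ using (ℤ; 0ℤ; 1ℤ; _⊖_)
import Data.Integer.Properties as ℤ
open import Data.Bool using (true; false; if_then_else_; T)
open import Data.Bool.Properties using (T-≡; if-cong; if-float)
open import Data.Fin using (Fin; zero; suc; toℕ; fromℕ; inject₁)
open import Data.Fin.Properties using (toℕ<n; toℕ-fromℕ; toℕ-inject₁)
open import Data.Vec as Vec using (Vec; []; _∷_; map; lookup; replicate; iterate; zipWith)
open import Data.Vec.Properties
  using (lookup-zipWith; lookup-replicate; lookup-map; tabulate∘lookup; tabulate-cong; zipWith-identityˡ; ∷-injectiveʳ)
open import Data.List as List using (List; []; _∷_; _++_; length; applyUpTo; upTo)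
import Data.List.Properties as List
open import Data.List.Membership.Propositional using (_∈_)
open import Data.List.Membership.Propositional.Properties using (∈-map⁺; ∈-map⁻; ∈-++⁺ˡ; ∈-++⁺ʳ; ∈-++⁻)
open import Data.List.Relation.Unary.All as All using (All; []; _∷_)
open import Data.List.Relation.Unary.AllPairs as AllPairs using (AllPairs; []; _∷_)
import Data.List.Relation.Unary.AllPairs.Properties as AllPairs
open import Data.List.Relation.Unary.Any using (here)
open import Data.List.Relation.Unary.Unique.Propositional using (Unique)
import Data.List.Relation.Unary.Unique.Propositional.Properties as Unique
open import Data.Product using (Σ; ∃; ∃₂; _×_; _,_; proj₂)
open import Data.Sum as Sum using (_⊎_; inj₁; inj₂; [_,_]′)
open import Data.Empty using (⊥-elim)
open import Function using (id; _∘_)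
open import Function.Bundles using (_⇔_; mk⇔; Equivalence)
open import Induction.WellFounded using (Acc; acc)
open import Relation.Binary.PropositionalEquality hiding ([_])
open import Relation.Binary.Definitions using (tri<; tri≈; tri>)
open import Relation.Binary.Construct.Closure.Transitive using ([_]; _∷_)
open import Relation.Nullary using (¬_; yes; no)

if-≤ᵇ-yes : ∀ {A : Set} {k n} {x y : A} → k ≤ n → (if k ≤ᵇ n then x else y) ≡ x
if-≤ᵇ-yes k≤n = if-cong (Equivalence.to T-≡ (ℕ.≤⇒≤ᵇ k≤n))

if-≤ᵇ-no : ∀ {A : Set} {k n} {x y : A} → ¬ k ≤ n → (if k ≤ᵇ n then x else y) ≡ y
if-≤ᵇ-no {k = k} {n} k≰n with k ≤ᵇ n | ℕ.≤ᵇ⇒≤ k n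
... | false | _ = refl
... | true  | k≤n = ⊥-elim (k≰n (k≤n _))

∸-comm : ∀ n m k → n ∸ m ∸ k ≡ n ∸ k ∸ m
∸-comm n m k =
  trans (ℕ.∸-+-assoc n m k) (trans (cong (n ∸_) (ℕ.+-comm m k)) (sym (ℕ.∸-+-assoc n k m)))

≤∸⇒≤∸ : ∀ {m n k} → m ≤ n → k ≤ n ∸ m → m ≤ n ∸ k
≤∸⇒≤∸ {m} {n} {k} m≤n k≤n∸m =
  ℕ.m+n≤o⇒m≤o∸n m (subst (_≤ n) (ℕ.+-comm k m) (ℕ.m≤o∸n⇒m+n≤o k m≤n k≤n∸m))

module PowerSeries where

  open import Data.Integer.Base using (+_; _+_; _-_; _*_)
  open import Data.Integer.Tactic.RingSolver using (solve-∀)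

  ∑< : ℕ → (ℕ → ℤ) → ℤ
  ∑< N h = sumℤ (applyUpTo h N)

  ∑<-cong : ∀ N {h h′ : ℕ → ℤ} → (∀ m → m < N → h m ≡ h′ m) → ∑< N h ≡ ∑< N h′
  ∑<-cong zero    _  = refl
  ∑<-cong (suc N) eq = cong₂ _+_ (eq 0 (s≤s z≤n)) (∑<-cong N (λ m m<N → eq (suc m) (s≤s m<N)))

  ∑<-zero : ∀ N {h : ℕ → ℤ} → (∀ m → m < N → h m ≡ 0ℤ) → ∑< N h ≡ 0ℤ
  ∑<-zero zero    _  = refl
  ∑<-zero (suc N) eq = cong₂ _+_ (eq 0 (s≤s z≤n)) (∑<-zero N (λ m m<N → eq (suc m) (s≤s m<N)))

  ∑<-extend : ∀ N M {h : ℕ → ℤ} → N ≤ M → (∀ m → N ≤ m → m < M → h m ≡ 0ℤ) → ∑< M h ≡ ∑< N h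
  ∑<-extend zero    M       _         eq = ∑<-zero M (λ m → eq m z≤n)
  ∑<-extend (suc N) (suc M) {h} (s≤s N≤M) eq =
    cong (λ s → h 0 + s) (∑<-extend N M N≤M (λ m N≤m m<M → eq (suc m) (s≤s N≤m) (s≤s m<M)))

  ∑<-single : ∀ N a {h : ℕ → ℤ} → a < N → (∀ m → m < N → m ≢ a → h m ≡ 0ℤ) → ∑< N h ≡ h a
  ∑<-single (suc N) zero    {h} _         eq = trans
    (cong (λ s → h 0 + s) (∑<-zero N (λ m m<N → eq (suc m) (s≤s m<N) λ ())))
    (ℤ.+-identityʳ (h 0))
  ∑<-single (suc N) (suc a) {h} (s≤s a<N) eq = trans
    (cong (_+ ∑< N (λ m → h (suc m))) (eq 0 (s≤s z≤n) λ ()))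
    (trans (ℤ.+-identityˡ _)
      (∑<-single N a a<N (λ m m<N m≢a → eq (suc m) (s≤s m<N) (m≢a ∘ ℕ.suc-injective))))

  ∑<-sub : ∀ N (h h′ : ℕ → ℤ) → ∑< N (λ m → h m - h′ m) ≡ ∑< N h - ∑< N h′
  ∑<-sub zero    h h′ = refl
  ∑<-sub (suc N) h h′ = trans (cong (λ s → h 0 - h′ 0 + s) (∑<-sub N (h ∘ suc) (h′ ∘ suc)))
    (regroup (h 0) (h′ 0) (∑< N (h ∘ suc)) (∑< N (h′ ∘ suc)))
    where
    regroup : ∀ a a′ b b′ → a - a′ + (b - b′) ≡ a + b - (a′ + b′)
    regroup = solve-∀

  ⊛-as-∑< : ∀ f g n → (f ⊛ g) n ≡ ∑< (suc n) (λ m → f m * g (n ∸ m))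
  ⊛-as-∑< f g n = cong sumℤ (List.map-applyUpTo id (λ m → f m * g (n ∸ m)) (suc n))

  ∇ : ℕ → PS → PS
  ∇ k f n = f n - (if k ≤ᵇ n then f (n ∸ k) else 0ℤ)

  ∇-cong : ∀ k {f g : PS} → f ≗ g → ∇ k f ≗ ∇ k g
  ∇-cong k eq n = cong₂ _-_ (eq n) (cong (λ t → if k ≤ᵇ n then t else 0ℤ) (eq (n ∸ k)))

  ⊛-congˡ : ∀ {f f′} g → f ≗ f′ → f ⊛ g ≗ f′ ⊛ g
  ⊛-congˡ g eq n = cong sumℤ (List.map-cong (λ m → cong (_* g (n ∸ m)) (eq m)) (upTo (suc n)))

  ⊛-congʳ : ∀ f {g g′} → g ≗ g′ → f ⊛ g ≗ f ⊛ g′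
  ⊛-congʳ f eq n = cong sumℤ (List.map-cong (λ m → cong (f m *_) (eq (n ∸ m))) (upTo (suc n)))

  𝟙-pos : ∀ {k} → 0 < k → 𝟙 k ≡ 0ℤ
  𝟙-pos {suc k} _ = refl

  ⊛-identityʳ : ∀ f → f ⊛ 𝟙 ≗ f
  ⊛-identityʳ f n = begin
    (f ⊛ 𝟙) n                           ≡⟨ ⊛-as-∑< f 𝟙 n ⟩
    ∑< (suc n) (λ m → f m * 𝟙 (n ∸ m))  ≡⟨ ∑<-single (suc n) n ℕ.≤-refl off-diagonal ⟩
    f n * 𝟙 (n ∸ n)                     ≡⟨ cong (λ t → f n * 𝟙 t) (ℕ.n∸n≡0 n) ⟩
    f n * 1ℤ                            ≡⟨ ℤ.*-identityʳ (f n) ⟩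
    f n                                 ∎
    where
    open ≡-Reasoning
    off-diagonal : ∀ m → m < suc n → m ≢ n → f m * 𝟙 (n ∸ m) ≡ 0ℤ
    off-diagonal m m≤n m≢n = trans
      (cong (f m *_) (𝟙-pos (ℕ.m<n⇒0<n∸m (ℕ.≤∧≢⇒< (s≤s⁻¹ m≤n) m≢n))))
      (ℤ.*-zeroʳ (f m))

  t^-coefficient : ∀ n k → (if n ≡ᵇ k then 1ℤ else 0ℤ) ≡ (if k ≤ᵇ n then 𝟙 (n ∸ k) else 0ℤ)
  t^-coefficient zero    zero          = refl
  t^-coefficient zero    (suc k)       = refl
  t^-coefficient (suc n) zero          = refl
  t^-coefficient (suc n) (suc zero)    = t^-coefficient n zero
  t^-coefficient (suc n) (suc (suc k)) = t^-coefficient n (suc k)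

  1-t^≗∇𝟙 : ∀ k → 1-t^ k ≗ ∇ k 𝟙
  1-t^≗∇𝟙 k n = cong (𝟙 n -_) (t^-coefficient n k)

  ⊛-∇ : ∀ k f g → f ⊛ ∇ k g ≗ ∇ k (f ⊛ g)
  ⊛-∇ k f g n = begin
    (f ⊛ ∇ k g) n
      ≡⟨ ⊛-as-∑< f (∇ k g) n ⟩
    ∑< (suc n) (λ m → f m * ∇ k g (n ∸ m))
      ≡⟨ ∑<-cong (suc n) (λ m _ → distrib (f m) (g (n ∸ m)) (shifted m)) ⟩
    ∑< (suc n) (λ m → f m * g (n ∸ m) - f m * shifted m)
      ≡⟨ ∑<-sub (suc n) (λ m → f m * g (n ∸ m)) (λ m → f m * shifted m) ⟩
    ∑< (suc n) (λ m → f m * g (n ∸ m)) - ∑< (suc n) (λ m → f m * shifted m)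
      ≡⟨ cong₂ _-_ (sym (⊛-as-∑< f g n)) shifted-sum ⟩
    ∇ k (f ⊛ g) n
      ∎
    where
    open ≡-Reasoning
    shifted : ℕ → ℤ
    shifted m = if k ≤ᵇ n ∸ m then g (n ∸ m ∸ k) else 0ℤ
    distrib : ∀ a b c → a * (b - c) ≡ a * b - a * c
    distrib = solve-∀
    vanish : ∀ m → ¬ k ≤ n ∸ m → f m * shifted m ≡ 0ℤ
    vanish m k≰n∸m = trans (cong (f m *_) (if-≤ᵇ-no k≰n∸m)) (ℤ.*-zeroʳ (f m))
    shifted-sum : ∑< (suc n) (λ m → f m * shifted m) ≡ (if k ≤ᵇ n then (f ⊛ g) (n ∸ k) else 0ℤ)
    shifted-sum with k ℕ.≤? n
    ... | no k≰n = trans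
      (∑<-zero (suc n) (λ m _ → vanish m (λ k≤n∸m → k≰n (ℕ.≤-trans k≤n∸m (ℕ.m∸n≤m n m)))))
      (sym (if-≤ᵇ-no k≰n))
    ... | yes k≤n = begin
      ∑< (suc n) (λ m → f m * shifted m)
        ≡⟨ ∑<-extend (suc (n ∸ k)) (suc n) (s≤s (ℕ.m∸n≤m n k))
             (λ m n∸k<m m≤n → vanish m (λ k≤n∸m → ℕ.<⇒≱ n∸k<m (≤∸⇒≤∸ (s≤s⁻¹ m≤n) k≤n∸m))) ⟩
      ∑< (suc (n ∸ k)) (λ m → f m * shifted m)
        ≡⟨ ∑<-cong (suc (n ∸ k)) (λ m m≤n∸k → cong (f m *_)
             (trans (if-≤ᵇ-yes {y = 0ℤ} (≤∸⇒≤∸ k≤n (s≤s⁻¹ m≤n∸k))) (cong g (∸-comm n m k)))) ⟩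
      ∑< (suc (n ∸ k)) (λ m → f m * g (n ∸ k ∸ m))
        ≡⟨ ⊛-as-∑< f g (n ∸ k) ⟨
      (f ⊛ g) (n ∸ k)
        ≡⟨ if-≤ᵇ-yes k≤n ⟨
      (if k ≤ᵇ n then (f ⊛ g) (n ∸ k) else 0ℤ)
        ∎

  ⊛-1-t^ : ∀ k f → f ⊛ 1-t^ k ≗ ∇ k f
  ⊛-1-t^ k f n = begin
    (f ⊛ 1-t^ k) n  ≡⟨ ⊛-congʳ f (1-t^≗∇𝟙 k) n ⟩
    (f ⊛ ∇ k 𝟙) n   ≡⟨ ⊛-∇ k f 𝟙 n ⟩
    ∇ k (f ⊛ 𝟙) n   ≡⟨ ∇-cong k (⊛-identityʳ f) n ⟩
    ∇ k f n         ∎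
    where open ≡-Reasoning

  ∇-ofℕ : ∀ k {c c′ : ℕ → ℕ} → (∀ n → c n ≡ c′ n ℕ.+ (if k ≤ᵇ n then c (n ∸ k) else 0)) →
          ∇ k (ofℕ c) ≗ ofℕ c′
  ∇-ofℕ k {c} {c′} rec n = begin
    + c n - (if k ≤ᵇ n then + c (n ∸ k) else 0ℤ)
      ≡⟨ cong₂ _-_ (cong +_ (rec n)) (sym (if-float +_ (k ≤ᵇ n))) ⟩
    + (c′ n ℕ.+ r) - + r
      ≡⟨ cong (_- + r) (ℤ.pos-+ (c′ n) r) ⟩
    + c′ n + + r - + r
      ≡⟨ cancel (+ c′ n) (+ r) ⟩
    + c′ n
      ∎
    where
    open ≡-Reasoning
    r = if k ≤ᵇ n then c (n ∸ k) else 0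
    cancel : ∀ x y → x + y - y ≡ x
    cancel = solve-∀


unit : ∀ {m} → Fin m → Vec ℕ m
unit zero    = 1 ∷ replicate _ 0
unit (suc k) = 0 ∷ unit k

pos : ∀ {d} → Fin d → ℕ
pos l = suc (toℕ l)

module Encoding where
  open import Data.Integer.Base using (+_; _+_; _-_)
  open import Data.Integer.Tactic.RingSolver using (solve-∀)

  δ-unit : ∀ {m} (k l : Fin m) → δ k l ≡ + lookup (unit k) l
  δ-unit zero    zero    = refl
  δ-unit zero    (suc l) = cong +_ (sym (lookup-replicate l 0))
  δ-unit (suc k) zero    = refl
  δ-unit (suc k) (suc l) = δ-unit k l

  index-difference : ∀ {d} (i j k : Fin d) → idx k - idx i - idx j ≡ pos k ⊖ (pos i ℕ.+ pos j)
  index-difference i j k = begin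
    + pos k - + pos i - + pos j      ≡⟨ regroup (+ pos k) (+ pos i) (+ pos j) ⟩
    + pos k - (+ pos i + + pos j)    ≡⟨ cong (λ t → + pos k - t) (ℤ.pos-+ (pos i) (pos j)) ⟨
    + pos k - + (pos i ℕ.+ pos j)    ≡⟨ ℤ.m-n≡m⊖n (pos k) (pos i ℕ.+ pos j) ⟩
    pos k ⊖ (pos i ℕ.+ pos j)        ∎
    where
    open ≡-Reasoning
    regroup : ∀ x y z → x - y - z ≡ x - (y + z)
    regroup = solve-∀

  sum⇔difference : ∀ x y z u v → u + (v + x) ≡ z + y ⇔ x - y ≡ z - u - v
  sum⇔difference x y z u v = mk⇔
    (λ eq → ℤ.i-j≡0⇒i≡j (x - y) (z - u - v) (begin
      x - y - (z - u - v)      ≡⟨ regroup x y z u v ⟨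
      u + (v + x) - (z + y)    ≡⟨ cong (_- (z + y)) eq ⟩
      z + y - (z + y)          ≡⟨ ℤ.+-inverseʳ (z + y) ⟩
      0ℤ                       ∎))
    (λ eq → ℤ.i-j≡0⇒i≡j (u + (v + x)) (z + y) (begin
      u + (v + x) - (z + y)    ≡⟨ regroup x y z u v ⟩
      x - y - (z - u - v)      ≡⟨ cong (_- (z - u - v)) eq ⟩
      z - u - v - (z - u - v)  ≡⟨ ℤ.+-inverseʳ (z - u - v) ⟩
      0ℤ                       ∎))
    where
    open ≡-Reasoning
    regroup : ∀ x y z u v → u + (v + x) - (z + y) ≡ x - y - (z - u - v)
    regroup = solve-∀

  balance⇔difference : ∀ {d} (v w : Λ d) (i j k : Fin d) l →
    lookup (unit i) l ℕ.+ (lookup (unit j) l ℕ.+ lookup v l) ≡ lookup (unit k) l ℕ.+ lookup w l ⇔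
    + lookup v l - + lookup w l ≡ δ k l - δ i l - δ j l
  balance⇔difference v w i j k l = mk⇔
    (λ eq → trans (Equivalence.to ℤ-version (trans (sym (pos-+₃ e f a)) (trans (cong +_ eq) (ℤ.pos-+ c b))))
      (sym δ≡unit))
    (λ eq → ℤ.+-injective (trans (pos-+₃ e f a)
      (trans (Equivalence.from ℤ-version (trans eq δ≡unit)) (sym (ℤ.pos-+ c b)))))
    where
    a = lookup v l
    b = lookup w l
    c = lookup (unit k) l
    e = lookup (unit i) l
    f = lookup (unit j) l
    ℤ-version = sum⇔difference (+ a) (+ b) (+ c) (+ e) (+ f)
    pos-+₃ : ∀ x y z → + (x ℕ.+ (y ℕ.+ z)) ≡ + x + (+ y + + z)
    pos-+₃ x y z = trans (ℤ.pos-+ x (y ℕ.+ z)) (cong (λ t → + x + t) (ℤ.pos-+ y z))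
    δ≡unit : δ k l - δ i l - δ j l ≡ + c - + e - + f
    δ≡unit = cong₂ _-_ (cong₂ _-_ (δ-unit k l) (δ-unit i l)) (δ-unit j l)

open import Data.Nat.Base using (_+_; _*_)
open import Data.Nat.Tactic.RingSolver using (solve-∀)
open PowerSeries
open Encoding

infixl 7 _·_
_·_ : ∀ {m} → Vec ℕ m → Vec ℕ m → ℕ
[]       · []       = 0
(c ∷ cs) · (x ∷ xs) = c * x + cs · xs

incHead : ∀ {m} → Vec ℕ (suc m) → Vec ℕ (suc m)
incHead (x ∷ xs) = suc x ∷ xs

incHead-injective : ∀ {m} {xs ys : Vec ℕ (suc m)} → incHead xs ≡ incHead ys → xs ≡ ys
incHead-injective {xs = _ ∷ _} {_ ∷ _} refl = refl

-- The solutions x of map suc ws · x ≡ n: weights are stored minus one, so they are positive.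
-- The first argument is fuel; any fuel ≥ n gives the same list (solutionsWithin-fuel).
solutionsWithin : ℕ → ∀ {m} → Vec ℕ m → ℕ → List (Vec ℕ m)
solutionsWithin _       []       zero    = [] ∷ []
solutionsWithin _       []       (suc _) = []
solutionsWithin zero    (s ∷ ws) n       = List.map (0 ∷_) (solutionsWithin zero ws n)
solutionsWithin (suc f) (s ∷ ws) n       =
  List.map (0 ∷_) (solutionsWithin (suc f) ws n) ++
  (if suc s ≤ᵇ n then List.map incHead (solutionsWithin f (s ∷ ws) (n ∸ suc s)) else [])

solutions : ∀ {m} → Vec ℕ m → ℕ → List (Vec ℕ m)
solutions ws n = solutionsWithin n ws n

count : ∀ {m} → Vec ℕ m → ℕ → ℕ
count ws n = length (solutions ws n)

∸-fuel : ∀ {n f} s → n ≤ suc f → n ∸ suc s ≤ f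
∸-fuel {zero}  s _         = z≤n
∸-fuel {suc n} s (s≤s n≤f) = ℕ.≤-trans (ℕ.m∸n≤m n s) n≤f

solutionsWithin-fuel : ∀ f f′ {m} (ws : Vec ℕ m) n → n ≤ f → n ≤ f′ →
                       solutionsWithin f ws n ≡ solutionsWithin f′ ws n
solutionsWithin-fuel _ _ [] zero    _ _ = refl
solutionsWithin-fuel _ _ [] (suc n) _ _ = refl
solutionsWithin-fuel zero    zero     (s ∷ ws) n _ _ = refl
solutionsWithin-fuel zero    (suc f′) (s ∷ ws) n z≤n n≤f′ = trans
  (cong (List.map (0 ∷_)) (solutionsWithin-fuel zero (suc f′) ws 0 z≤n n≤f′))
  (sym (List.++-identityʳ _))
solutionsWithin-fuel (suc f) zero     (s ∷ ws) n n≤f z≤n = trans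
  (List.++-identityʳ _)
  (cong (List.map (0 ∷_)) (solutionsWithin-fuel (suc f) zero ws 0 n≤f z≤n))
solutionsWithin-fuel (suc f) (suc f′) (s ∷ ws) n n≤f n≤f′ = cong₂ _++_
  (cong (List.map (0 ∷_)) (solutionsWithin-fuel (suc f) (suc f′) ws n n≤f n≤f′))
  (cong (λ xs → if suc s ≤ᵇ n then List.map incHead xs else [])
    (solutionsWithin-fuel f f′ (s ∷ ws) (n ∸ suc s) (∸-fuel s n≤f) (∸-fuel s n≤f′)))

·-head-zero : ∀ {m} c (cs : Vec ℕ m) xs → (c ∷ cs) · (0 ∷ xs) ≡ cs · xs
·-head-zero c cs xs = cong (_+ cs · xs) (ℕ.*-zeroʳ c)

·-incHead : ∀ {m} c (cs : Vec ℕ m) x xs → (c ∷ cs) · incHead (x ∷ xs) ≡ c + (c ∷ cs) · (x ∷ xs)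
·-incHead c cs x xs = trans (cong (_+ cs · xs) (ℕ.*-suc c x)) (ℕ.+-assoc c (c * x) (cs · xs))

module _ {A : Set} {xs : List A} where

  ∈-if⁻ : ∀ b {x} → x ∈ (if b then xs else []) → T b × x ∈ xs
  ∈-if⁻ true x∈xs = _ , x∈xs

  ∈-if⁺ : ∀ {b x} → T b → x ∈ xs → x ∈ (if b then xs else [])
  ∈-if⁺ {true} _ x∈xs = x∈xs

  unique-if : ∀ b → Unique xs → Unique (if b then xs else [])
  unique-if true  u = u
  unique-if false _ = []

map⁺-injectiveOn : ∀ {A B : Set} {P : A → Set} {f : A → B} {xs : List A} →
                   (∀ {x y} → P x → P y → f x ≡ f y → x ≡ y) →
                   All P xs → Unique xs → Unique (List.map f xs)
map⁺-injectiveOn {P = P} {f} injective ps u = AllPairs.map⁺ (separate ps u)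
  where
  separate : ∀ {xs} → All P xs → Unique xs → AllPairs (λ x y → f x ≢ f y) xs
  separate []         []         = []
  separate (px ∷ ps) (x∉ ∷ u) =
    All.zipWith (λ (py , x≢y) → x≢y ∘ injective px py) (ps , x∉) ∷ separate ps u

∈-solutionsWithin⁻ : ∀ f {m} (ws : Vec ℕ m) n {x} → x ∈ solutionsWithin f ws n → map suc ws · x ≡ n
∈-solutionsWithin⁻ _ [] zero (here refl) = refl
∈-solutionsWithin⁻ zero (s ∷ ws) n x∈ with ∈-map⁻ (0 ∷_) x∈
... | xs , xs∈ , refl = trans (·-head-zero (suc s) (map suc ws) xs) (∈-solutionsWithin⁻ zero ws n xs∈)
∈-solutionsWithin⁻ (suc f) (s ∷ ws) n x∈ with ∈-++⁻ (List.map (0 ∷_) (solutionsWithin (suc f) ws n)) x∈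
... | inj₁ x∈₁ with ∈-map⁻ (0 ∷_) x∈₁
...   | xs , xs∈ , refl = trans (·-head-zero (suc s) (map suc ws) xs) (∈-solutionsWithin⁻ (suc f) ws n xs∈)
∈-solutionsWithin⁻ (suc f) (s ∷ ws) n x∈ | inj₂ x∈₂ with ∈-if⁻ (suc s ≤ᵇ n) x∈₂
... | s<n , x∈₃ with ∈-map⁻ incHead x∈₃
...   | x ∷ xs , xs∈ , refl = begin
  map suc (s ∷ ws) · incHead (x ∷ xs)  ≡⟨ ·-incHead (suc s) (map suc ws) x xs ⟩
  suc s + map suc (s ∷ ws) · (x ∷ xs)  ≡⟨ cong (suc s +_) (∈-solutionsWithin⁻ f (s ∷ ws) (n ∸ suc s) xs∈) ⟩
  suc s + (n ∸ suc s)                  ≡⟨ ℕ.m+[n∸m]≡n (ℕ.≤ᵇ⇒≤ (suc s) n s<n) ⟩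
  n                                    ∎
  where open ≡-Reasoning

∈-solutionsWithin⁺ : ∀ f {m} (ws : Vec ℕ m) n {x} → n ≤ f → map suc ws · x ≡ n →
                     x ∈ solutionsWithin f ws n
∈-solutionsWithin⁺ _ [] zero {[]} _ _ = here refl
∈-solutionsWithin⁺ zero (s ∷ ws) n {zero ∷ xs} n≤f eq =
  ∈-map⁺ (0 ∷_) (∈-solutionsWithin⁺ zero ws n n≤f (trans (sym (·-head-zero (suc s) (map suc ws) xs)) eq))
∈-solutionsWithin⁺ zero (s ∷ ws) .zero {suc x ∷ xs} z≤n eq
  with () ← trans (sym (·-incHead (suc s) (map suc ws) x xs)) eq
∈-solutionsWithin⁺ (suc f) (s ∷ ws) n {zero ∷ xs} n≤f eq = ∈-++⁺ˡ
  (∈-map⁺ (0 ∷_)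
    (∈-solutionsWithin⁺ (suc f) ws n n≤f (trans (sym (·-head-zero (suc s) (map suc ws) xs)) eq)))
∈-solutionsWithin⁺ (suc f) (s ∷ ws) n {suc x ∷ xs} n≤f eq =
  ∈-++⁺ʳ (List.map (0 ∷_) (solutionsWithin (suc f) ws n)) (∈-if⁺ (ℕ.≤⇒≤ᵇ s<n)
    (∈-map⁺ incHead (∈-solutionsWithin⁺ f (s ∷ ws) (n ∸ suc s) (∸-fuel s n≤f) rest)))
  where
  split : suc s + map suc (s ∷ ws) · (x ∷ xs) ≡ n
  split = trans (sym (·-incHead (suc s) (map suc ws) x xs)) eq
  s<n : suc s ≤ n
  s<n = subst (suc s ≤_) split (ℕ.m≤m+n (suc s) _)
  rest : map suc (s ∷ ws) · (x ∷ xs) ≡ n ∸ suc s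
  rest = trans (sym (ℕ.m+n∸m≡n (suc s) _)) (cong (_∸ suc s) split)

solutionsWithin-unique : ∀ f {m} (ws : Vec ℕ m) n → Unique (solutionsWithin f ws n)
solutionsWithin-unique _ [] zero    = [] ∷ []
solutionsWithin-unique _ [] (suc n) = []
solutionsWithin-unique zero (s ∷ ws) n = Unique.map⁺ ∷-injectiveʳ (solutionsWithin-unique zero ws n)
solutionsWithin-unique (suc f) (s ∷ ws) n = Unique.++⁺
  (Unique.map⁺ ∷-injectiveʳ (solutionsWithin-unique (suc f) ws n))
  (unique-if (suc s ≤ᵇ n) (Unique.map⁺ incHead-injective (solutionsWithin-unique f (s ∷ ws) (n ∸ suc s))))
  disjoint
  where
  disjoint : ∀ {x} → ¬ (x ∈ List.map (0 ∷_) (solutionsWithin (suc f) ws n) ×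
                         x ∈ (if suc s ≤ᵇ n
                              then List.map incHead (solutionsWithin f (s ∷ ws) (n ∸ suc s)) else []))
  disjoint (x∈₁ , x∈₂) with ∈-map⁻ (0 ∷_) x∈₁ | ∈-map⁻ incHead (proj₂ (∈-if⁻ (suc s ≤ᵇ n) x∈₂))
  ... | _ , _ , refl | _ ∷ _ , _ , ()

∈-solutions⁻ : ∀ {m} (ws : Vec ℕ m) n {x} → x ∈ solutions ws n → map suc ws · x ≡ n
∈-solutions⁻ ws n = ∈-solutionsWithin⁻ n ws n

∈-solutions⁺ : ∀ {m} (ws : Vec ℕ m) n {x} → map suc ws · x ≡ n → x ∈ solutions ws n
∈-solutions⁺ ws n = ∈-solutionsWithin⁺ n ws n ℕ.≤-refl

solutions-unique : ∀ {m} (ws : Vec ℕ m) n → Unique (solutions ws n)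
solutions-unique ws n = solutionsWithin-unique n ws n

count-∷ : ∀ {m} s (ws : Vec ℕ m) n →
          count (s ∷ ws) n ≡ count ws n + (if suc s ≤ᵇ n then count (s ∷ ws) (n ∸ suc s) else 0)
count-∷ s ws zero = trans (List.length-map (0 ∷_) (solutions ws 0)) (sym (ℕ.+-identityʳ _))
count-∷ s ws (suc n) = begin
  length (List.map (0 ∷_) (solutions ws (suc n)) ++ others)
    ≡⟨ List.length-++ (List.map (0 ∷_) (solutions ws (suc n))) ⟩
  length (List.map (0 ∷_) (solutions ws (suc n))) + length others
    ≡⟨ cong₂ _+_ (List.length-map (0 ∷_) (solutions ws (suc n))) (if-float length (suc s ≤ᵇ suc n)) ⟩
  count ws (suc n) + (if suc s ≤ᵇ suc n then length (List.map incHead smaller) else 0)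
    ≡⟨ cong (λ k → count ws (suc n) + (if suc s ≤ᵇ suc n then k else 0)) smaller-count ⟩
  count ws (suc n) + (if suc s ≤ᵇ suc n then count (s ∷ ws) (n ∸ s) else 0)
    ∎
  where
  open ≡-Reasoning
  smaller = solutionsWithin n (s ∷ ws) (n ∸ s)
  others = if suc s ≤ᵇ suc n then List.map incHead smaller else []
  smaller-count : length (List.map incHead smaller) ≡ count (s ∷ ws) (n ∸ s)
  smaller-count = trans (List.length-map incHead smaller)
    (cong length (solutionsWithin-fuel n (n ∸ s) (s ∷ ws) (n ∸ s) (ℕ.m∸n≤m n s) ℕ.≤-refl))

infixr 6 _⊕_
_⊕_ : ∀ {m} → Vec ℕ m → Vec ℕ m → Vec ℕ m
_⊕_ = zipWith _+_

≡-fromLookup : ∀ {m} {u v : Vec ℕ m} → (∀ l → lookup u l ≡ lookup v l) → u ≡ v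
≡-fromLookup {u = u} {v} eq =
  trans (sym (tabulate∘lookup u)) (trans (tabulate-cong eq) (tabulate∘lookup v))

lookup-⊕ : ∀ {m} (u v : Vec ℕ m) l → lookup (u ⊕ v) l ≡ lookup u l + lookup v l
lookup-⊕ u v l = lookup-zipWith _+_ l u v

⊕-swap : ∀ {m} (u v w : Vec ℕ m) → u ⊕ v ⊕ w ≡ v ⊕ u ⊕ w
⊕-swap []       []       []       = refl
⊕-swap (x ∷ u) (y ∷ v) (z ∷ w) = cong₂ _∷_ (swap x y z) (⊕-swap u v w)
  where
  swap : ∀ x y z → x + (y + z) ≡ y + (x + z)
  swap = solve-∀

unit-zero-⊕ : ∀ {m} x (v : Vec ℕ m) → unit zero ⊕ (x ∷ v) ≡ suc x ∷ v
unit-zero-⊕ x v = cong (suc x ∷_) (zipWith-identityˡ ℕ.+-identityˡ v)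

zeros-or-unit : ∀ {m} (v : Vec ℕ m) → v ≡ replicate m 0 ⊎ ∃₂ λ k u → v ≡ unit k ⊕ u
zeros-or-unit []          = inj₁ refl
zeros-or-unit (suc x ∷ v) = inj₂ (zero , x ∷ v , sym (unit-zero-⊕ x v))
zeros-or-unit (zero ∷ v) with zeros-or-unit v
... | inj₁ v≡0           = inj₁ (cong (0 ∷_) v≡0)
... | inj₂ (k , u , v≡) = inj₂ (suc k , 0 ∷ u , cong (0 ∷_) v≡)

·-zeroʳ : ∀ {m} (cs : Vec ℕ m) → cs · replicate m 0 ≡ 0
·-zeroʳ []       = refl
·-zeroʳ (c ∷ cs) = cong₂ _+_ (ℕ.*-zeroʳ c) (·-zeroʳ cs)

·-distribˡ-⊕ : ∀ {m} (cs u v : Vec ℕ m) → cs · (u ⊕ v) ≡ cs · u + cs · v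
·-distribˡ-⊕ []       []      []      = refl
·-distribˡ-⊕ (c ∷ cs) (x ∷ u) (y ∷ v) =
  trans (cong (λ t → c * (x + y) + t) (·-distribˡ-⊕ cs u v)) (regroup c x y (cs · u) (cs · v))
  where
  regroup : ∀ c x y a b → c * (x + y) + (a + b) ≡ c * x + a + (c * y + b)
  regroup = solve-∀

·-unit : ∀ {m} (cs : Vec ℕ m) k → cs · unit k ≡ lookup cs k
·-unit (c ∷ cs) zero    = trans (cong₂ _+_ (ℕ.*-identityʳ c) (·-zeroʳ cs)) (ℕ.+-identityʳ c)
·-unit (c ∷ cs) (suc k) = cong₂ _+_ (ℕ.*-zeroʳ c) (·-unit cs k)

·-unit-⊕ : ∀ {m} (cs : Vec ℕ m) k v → cs · (unit k ⊕ v) ≡ lookup cs k + cs · v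
·-unit-⊕ cs k v = trans (·-distribˡ-⊕ cs (unit k) v) (cong (_+ cs · v) (·-unit cs k))

∣-window : ∀ {d x} → d ∣ x → 0 < x → x < d + d → x ≡ d
∣-window (divides zero          refl) () _
∣-window (divides (suc zero)    x≡d)  _ _ = trans x≡d (ℕ.+-identityʳ _)
∣-window {d} (divides (suc (suc q)) refl) _ x<2d =
  ⊥-elim (ℕ.<⇒≱ x<2d (ℕ.+-monoʳ-≤ d (ℕ.m≤m+n d (q * d))))

divides-sum : ∀ {d a b} → 0 < a → a ≤ d → 0 < b → b ≤ d + d → d ∣ ℤ.∣ a ⊖ b ∣ → b ≡ a ⊎ b ≡ a + d
divides-sum {d} {a} {b} 0<a a≤d 0<b b≤2d d∣ with ℕ.<-cmp a b
... | tri≈ _ a≡b _ = inj₁ (sym a≡b)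
... | tri> _ _ b<a = ⊥-elim (ℕ.<-irrefl a∸b≡d a∸b<d)
  where
  a∸b<d : a ∸ b < d
  a∸b<d = ℕ.<-≤-trans (ℕ.∸-monoʳ-< 0<b (ℕ.<⇒≤ b<a)) a≤d
  a∸b≡d : a ∸ b ≡ d
  a∸b≡d = ∣-window (subst (d ∣_) (trans (ℤ.∣m⊖n∣≡∣n⊖m∣ a b) (ℤ.∣⊖∣-< b<a)) d∣)
    (ℕ.m<n⇒0<n∸m b<a) (ℕ.<-≤-trans a∸b<d (ℕ.m≤m+n d d))
... | tri< a<b _ _ = inj₂ (trans (sym (ℕ.m+[n∸m]≡n (ℕ.<⇒≤ a<b))) (cong (a +_) b∸a≡d))
  where
  b∸a≡d : b ∸ a ≡ d
  b∸a≡d = ∣-window (subst (d ∣_) (ℤ.∣⊖∣-< a<b) d∣)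
    (ℕ.m<n⇒0<n∸m a<b) (ℕ.<-≤-trans (ℕ.∸-monoʳ-< 0<a (ℕ.<⇒≤ a<b)) b≤2d)

wraps⇒divides : ∀ {d a b} → b ≡ a ⊎ b ≡ a + d → d ∣ ℤ.∣ a ⊖ b ∣
wraps⇒divides {d} {a} (inj₁ refl) = subst (d ∣_) (sym (cong ℤ.∣_∣ (ℤ.n⊖n≡0 a))) (d ∣0)
wraps⇒divides {d} {a} (inj₂ refl) =
  subst (d ∣_) (sym (trans (ℤ.∣⊖∣-≤ (ℕ.m≤m+n a d)) (ℕ.m+n∸m≡n a d))) ∣-refl

-- The relation ⋖ over ℕ: for indices in 1..d, d ∣ k - i - j says that i + j is k or k + d.
record Move {d} (v w : Λ d) : Set where
  constructor move
  field
    i j k   : Fin d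
    wraps   : pos i + pos j ≡ pos k ⊎ pos i + pos j ≡ pos k + d
    balance : unit i ⊕ unit j ⊕ v ≡ unit k ⊕ w

lookup-balance : ∀ {d} (i j : Fin d) v l →
                 lookup (unit i ⊕ unit j ⊕ v) l ≡ lookup (unit i) l + (lookup (unit j) l + lookup v l)
lookup-balance i j v l =
  trans (lookup-⊕ (unit i) _ l) (cong (lookup (unit i) l +_) (lookup-⊕ (unit j) v l))

⋖⇔Move : ∀ {d} {v w : Λ d} → v ⋖ w ⇔ Move v w
⋖⇔Move {d} {v} {w} = mk⇔ to from
  where
  to : v ⋖ w → Move v w
  to (step i j k d∣ diff) = move i j k
    (divides-sum (s≤s z≤n) (toℕ<n k) (s≤s z≤n) (ℕ.+-mono-≤ (toℕ<n i) (toℕ<n j))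
      (subst (λ t → d ∣ ℤ.∣ t ∣) (index-difference i j k) d∣))
    (≡-fromLookup λ l → trans (lookup-balance i j v l)
      (trans (Equivalence.from (balance⇔difference v w i j k l) (diff l)) (sym (lookup-⊕ (unit k) w l))))
  from : Move v w → v ⋖ w
  from (move i j k wraps balance) = step i j k
    (subst (λ t → d ∣ ℤ.∣ t ∣) (sym (index-difference i j k)) (wraps⇒divides wraps))
    (λ l → Equivalence.to (balance⇔difference v w i j k l)
      (trans (sym (lookup-balance i j v l))
        (trans (cong (λ u → lookup u l) balance) (lookup-⊕ (unit k) w l))))

range : (d : ℕ) → Vec ℕ d
range d = iterate suc 0 d

lookup-iterate-suc : ∀ {m} a (l : Fin m) → lookup (iterate suc a m) l ≡ a + toℕ l
lookup-iterate-suc a zero    = sym (ℕ.+-identityʳ a)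
lookup-iterate-suc a (suc l) = trans (lookup-iterate-suc (suc a) l) (sym (ℕ.+-suc a (toℕ l)))

weight : ∀ {d} → Λ d → ℕ
weight {d} w = map suc (range d) · w

depth : ∀ {d} → Λ d → ℕ
depth {d} w = range d · w

weight-unit-⊕ : ∀ {d} (k : Fin d) v → weight (unit k ⊕ v) ≡ pos k + weight v
weight-unit-⊕ {d} k v = trans (·-unit-⊕ (map suc (range d)) k v)
  (cong (_+ weight v) (trans (lookup-map k suc (range d)) (cong suc (lookup-iterate-suc 0 k))))

depth-unit-⊕ : ∀ {d} (k : Fin d) v → depth (unit k ⊕ v) ≡ toℕ k + depth v
depth-unit-⊕ {d} k v = trans (·-unit-⊕ (range d) k v) (cong (_+ depth v) (lookup-iterate-suc 0 k))

weight-Move : ∀ {d} {v w : Λ d} (m : Move v w) → let open Move m in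
              pos i + pos j + weight v ≡ pos k + weight w
weight-Move {v = v} {w} (move i j k _ balance) = begin
  pos i + pos j + weight v             ≡⟨ ℕ.+-assoc (pos i) (pos j) (weight v) ⟩
  pos i + (pos j + weight v)           ≡⟨ cong (pos i +_) (weight-unit-⊕ j v) ⟨
  pos i + weight (unit j ⊕ v)          ≡⟨ weight-unit-⊕ i (unit j ⊕ v) ⟨
  weight (unit i ⊕ unit j ⊕ v)         ≡⟨ cong weight balance ⟩
  weight (unit k ⊕ w)                  ≡⟨ weight-unit-⊕ k w ⟩
  pos k + weight w                     ∎
  where open ≡-Reasoning

weight-Move-cases : ∀ {d} {v w : Λ d} → Move v w → weight v ≡ weight w ⊎ d + weight v ≡ weight w
weight-Move-cases {d} {v} {w} m = Sum.map same one-more wraps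
  where
  open Move m
  same : pos i + pos j ≡ pos k → weight v ≡ weight w
  same e = ℕ.+-cancelˡ-≡ (pos k) _ _ (trans (cong (_+ weight v) (sym e)) (weight-Move m))
  one-more : pos i + pos j ≡ pos k + d → d + weight v ≡ weight w
  one-more e = ℕ.+-cancelˡ-≡ (pos k) _ _
    (trans (sym (ℕ.+-assoc (pos k) d (weight v))) (trans (cong (_+ weight v) (sym e)) (weight-Move m)))

*-suc-+ : ∀ d m x → d * suc m + x ≡ d * m + (d + x)
*-suc-+ = solve-∀

module BelowSet (d′ : ℕ) where

  d : ℕ
  d = suc d′

  last : Fin d
  last = fromℕ d′

  pos-last : pos last ≡ d
  pos-last = cong suc (toℕ-fromℕ d′)

  delete : (w : Λ d) → Move w (unit last ⊕ w)
  delete w = move last last last (inj₂ (cong (pos last +_) pos-last)) refl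

  pos-split : (k : Fin d′) → pos (inject₁ k) + pos {d} zero ≡ pos {d} (suc k)
  pos-split k = cong suc (trans (ℕ.+-comm (toℕ (inject₁ k)) 1) (cong suc (toℕ-inject₁ k)))

  split : (k : Fin d′) (r : Λ d) → Move (unit (suc k) ⊕ r) (unit (inject₁ k) ⊕ unit zero ⊕ r)
  split k r = move (inject₁ k) zero (suc k) (inj₁ (pos-split k))
    (trans (cong (unit (inject₁ k) ⊕_) (⊕-swap (unit zero) (unit (suc k)) r))
           (⊕-swap (unit (inject₁ k)) (unit (suc k)) (unit zero ⊕ r)))

  weight-split : ∀ (k : Fin d′) (r : Λ d) →
                 weight (unit (suc k) ⊕ r) ≡ weight (unit (inject₁ k) ⊕ unit zero ⊕ r)
  weight-split k r = ℕ.+-cancelˡ-≡ (pos (suc k)) _ _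
    (trans (cong (_+ weight (unit (suc k) ⊕ r)) (sym (pos-split k))) (weight-Move (split k r)))

  depth-split : ∀ (k : Fin d′) (r : Λ d) →
                depth (unit (suc k) ⊕ r) ≡ suc (depth (unit (inject₁ k) ⊕ unit zero ⊕ r))
  depth-split k r = begin
    depth (unit (suc k) ⊕ r)                ≡⟨ depth-unit-⊕ (suc k) r ⟩
    suc (toℕ k + depth r)                   ≡⟨ cong (λ t → suc (t + depth r)) (toℕ-inject₁ k) ⟨
    suc (toℕ k′ + depth r)                  ≡⟨ cong (λ t → suc (toℕ k′ + t)) (depth-unit-⊕ zero r) ⟨
    suc (toℕ k′ + depth (unit zero ⊕ r))    ≡⟨ cong suc (depth-unit-⊕ k′ (unit zero ⊕ r)) ⟨
    suc (depth (unit k′ ⊕ unit zero ⊕ r))   ∎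
    where
    open ≡-Reasoning
    k′ = inject₁ k

  ne₁-∷ : ∀ n → ne₁ {d} n ≡ n ∷ replicate d′ 0
  ne₁-∷ n = cong (n ∷_)
    (trans (tabulate-cong (λ l → sym (lookup-replicate l 0))) (tabulate∘lookup (replicate d′ 0)))

  weight-∷-zeros : ∀ x → weight {d} (x ∷ replicate d′ 0) ≡ x
  weight-∷-zeros x =
    trans (cong₂ _+_ (ℕ.*-identityˡ x) (·-zeroʳ (map suc (iterate suc 1 d′)))) (ℕ.+-identityʳ x)

  Admissible : ℕ → Λ d → Set
  Admissible n w = ∃ λ m → d * m + weight w ≡ n

  admissible-ne₁ : ∀ n → Admissible n (ne₁ n)
  admissible-ne₁ n = 0 , trans (cong₂ _+_ (ℕ.*-zeroʳ d) (cong weight (ne₁-∷ n))) (weight-∷-zeros n)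

  admissible-Move : ∀ {n} {v w : Λ d} → Move v w → Admissible n w → Admissible n v
  admissible-Move {v = v} mv (m , eq) = [ same , one-more ]′ (weight-Move-cases mv)
    where
    same = λ e → m , trans (cong (d * m +_) e) eq
    one-more = λ e → suc m , trans (*-suc-+ d m (weight v)) (trans (cong (d * m +_) e) eq)

  ≺-admissible : ∀ {n} {v w : Λ d} → v ≺ w → Admissible n w → Admissible n v
  ≺-admissible [ v⋖w ]      = admissible-Move (Equivalence.to ⋖⇔Move v⋖w)
  ≺-admissible (v⋖u ∷ u≺w) = admissible-Move (Equivalence.to ⋖⇔Move v⋖u) ∘ ≺-admissible u≺w

  below-⋖ : ∀ {n} {v w : Λ d} → v ⋖ w → Below d n w → Below d n v
  below-⋖ v⋖w (inj₁ refl) = inj₂ [ v⋖w ]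
  below-⋖ v⋖w (inj₂ w≺)   = inj₂ (v⋖w ∷ w≺)

  -- Splitting e(k+1) into e(k) + e(1) keeps the weight and lowers the depth by one.
  reach-weight : ∀ {n} (w : Λ d) → Acc _<_ (depth w) → weight w ≡ n → Below d n w
  reach-weight {n} (x ∷ v) (acc rs) w≡n with zeros-or-unit v
  ... | inj₁ refl =
    inj₁ (trans (cong (_∷ replicate d′ 0) (trans (sym (weight-∷-zeros x)) w≡n)) (sym (ne₁-∷ n)))
  ... | inj₂ (k , u , refl) = below-⋖ (Equivalence.from ⋖⇔Move (split k (x ∷ u)))
    (reach-weight _ (rs (ℕ.≤-reflexive (sym (depth-split k (x ∷ u)))))
      (trans (sym (weight-split k (x ∷ u))) w≡n))

  reach : ∀ {n} m (w : Λ d) → d * m + weight w ≡ n → Below d n w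
  reach zero    w eq =
    reach-weight w (<-wellFounded (depth w)) (trans (cong (_+ weight w) (sym (ℕ.*-zeroʳ d))) eq)
  reach (suc m) w eq = below-⋖ (Equivalence.from ⋖⇔Move (delete w)) (reach m (unit last ⊕ w)
    (trans (cong (d * m +_) (trans (weight-unit-⊕ last w) (cong (_+ weight w) pos-last)))
           (trans (sym (*-suc-+ d m (weight w))) eq)))

  below⇔admissible : ∀ {n} {w : Λ d} → Below d n w ⇔ Admissible n w
  below⇔admissible {n} = mk⇔ below⇒admissible (λ (m , eq) → reach m _ eq)
    where
    below⇒admissible : ∀ {w} → Below d n w → Admissible n w
    below⇒admissible (inj₁ refl) = admissible-ne₁ n
    below⇒admissible (inj₂ w≺)   = ≺-admissible w≺ (admissible-ne₁ n)

  hasCard : ∀ n → HasCard d n (count (d′ ∷ range d) n)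
  hasCard n = List.map Vec.tail sols , unique , (λ w → mk⇔ (to w) (from w)) , List.length-map Vec.tail sols
    where
    ws = d′ ∷ range d
    sols = solutions ws n
    solved = ∈-solutions⁻ ws n
    tail-injective : ∀ {x y} → map suc ws · x ≡ n → map suc ws · y ≡ n → Vec.tail x ≡ Vec.tail y → x ≡ y
    tail-injective {a ∷ w} {b ∷ .w} ea eb refl =
      cong (_∷ w) (ℕ.*-cancelˡ-≡ a b d (ℕ.+-cancelʳ-≡ (weight w) _ _ (trans ea (sym eb))))
    unique = map⁺-injectiveOn tail-injective (All.tabulate solved) (solutions-unique ws n)
    to : ∀ w → w ∈ List.map Vec.tail sols → Below d n w
    to w w∈ with ∈-map⁻ Vec.tail w∈
    ... | m ∷ w , m∷w∈ , refl = Equivalence.from below⇔admissible (m , solved m∷w∈)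
    from : ∀ w → Below d n w → w ∈ List.map Vec.tail sols
    from w below with Equivalence.to below⇔admissible below
    ... | m , eq = ∈-map⁺ Vec.tail (∈-solutions⁺ ws n {m ∷ w} eq)

∇-count : ∀ {m} s (ws : Vec ℕ m) → ∇ (suc s) (ofℕ (count (s ∷ ws))) ≗ ofℕ (count ws)
∇-count s ws = ∇-ofℕ (suc s) (count-∷ s ws)

count-[] : ofℕ (count []) ≗ 𝟙
count-[] zero    = refl
count-[] (suc n) = refl

-- Multiplying by (1 - t) ⋯ (1 - t^j) strips the weights 1, …, j off the front of range d.
count-⊛∏ : ∀ d j k → j + k ≡ d → ofℕ (count (range d)) ⊛ ∏1-t^ j ≗ ofℕ (count (iterate suc j k))
count-⊛∏ d zero    k refl = ⊛-identityʳ (ofℕ (count (range d)))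
count-⊛∏ d (suc j) k j+k≡d n = begin
  (f ⊛ ∏1-t^ (suc j)) n                              ≡⟨ ⊛-congʳ f (⊛-1-t^ (suc j) (∏1-t^ j)) n ⟩
  (f ⊛ ∇ (suc j) (∏1-t^ j)) n                        ≡⟨ ⊛-∇ (suc j) f (∏1-t^ j) n ⟩
  ∇ (suc j) (f ⊛ ∏1-t^ j) n                          ≡⟨ ∇-cong (suc j) (count-⊛∏ d j (suc k) j+1+k≡d) n ⟩
  ∇ (suc j) (ofℕ (count (iterate suc j (suc k)))) n  ≡⟨ ∇-count j (iterate suc (suc j) k) n ⟩
  ofℕ (count (iterate suc (suc j) k)) n              ∎
  where
  open ≡-Reasoning
  f = ofℕ (count (range d))
  j+1+k≡d = trans (ℕ.+-suc j k) j+k≡d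

generating-function : ∀ d′ → (ofℕ (count (d′ ∷ range (suc d′))) ⊛ 1-t^ (suc d′)) ⊛ ∏1-t^ (suc d′) ≗ 𝟙
generating-function d′ n = begin
  ((ofℕ (count (d′ ∷ range d)) ⊛ 1-t^ d) ⊛ ∏1-t^ d) n
    ≡⟨ ⊛-congˡ (∏1-t^ d) (λ m → trans (⊛-1-t^ d (ofℕ (count (d′ ∷ range d))) m) (∇-count d′ (range d) m)) n ⟩
  (ofℕ (count (range d)) ⊛ ∏1-t^ d) n
    ≡⟨ count-⊛∏ d d 0 (ℕ.+-identityʳ d) n ⟩
  ofℕ (count []) n
    ≡⟨ count-[] n ⟩
  𝟙 n
    ∎
  where
  open ≡-Reasoning
  d = suc d′

corollary7p2 : ∀ (d : ℕ) → 1 ≤ d →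
    Σ (ℕ → ℕ) λ C →
    (∀ n → HasCard d n (C n)) ×
    (∀ n → ((ofℕ C ⊛ 1-t^ d) ⊛ ∏1-t^ d) n ≡ 𝟙 n)
corollary7p2 (suc d′) _ = count (d′ ∷ range (suc d′)) , hasCard , generating-function d′
  where open BelowSet d′
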